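{- Let $G$ be a finite graph such that $\max(\alpha_M(G),\omega_M(G))\geq 2$. Then the elements of $\mathbb{M}(G)$ are pairwise disjoint.
   Context: Graphs are finite, simple and undirected. A subset $M\subseteq V(G)$ is a module of $G$ if every $v\in V(G)\setminus M$ is adjacent either to all vertices of $M$ or to none of them. $\omega_M(G)$ (resp. $\alpha_M(G)$) is the largest size of a module of $G$ that is a clique (resp. stable set) in $G$. $\mathbb{M}(G)$ is the family of inclusion-maximal elements among the modules of $G$ of size at least $2$ which are cliques or stable sets in $G$. -}

module Defs where

open import Data.Nat using (ℕ; _≤_)
open import Data.Fin using (Fin)
open import Data.Fin.Subset using (Subset; _∈_; _∉_; _⊆_; ∣_∣; _∩_; Empty)
open import Data.Product using (Σ; _×_; _,_)
open import Data.Sum using (_⊎_)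
open import Relation.Nullary using (¬_)
open import Relation.Binary.PropositionalEquality using (_≡_; _≢_)

record Graph (n : ℕ) : Set₁ where
  field
    Adj     : Fin n → Fin n → Set
    sym     : ∀ {u v} → Adj u v → Adj v u
    irrefl  : ∀ {u} → ¬ Adj u u

module _ {n : ℕ} (G : Graph n) where
  open Graph G

  IsModule : Subset n → Set
  IsModule M = ∀ v → v ∉ M →
    (∀ u → u ∈ M → Adj v u) ⊎ (∀ u → u ∈ M → ¬ Adj v u)

  IsClique : Subset n → Set
  IsClique M = ∀ u w → u ∈ M → w ∈ M → u ≢ w → Adj u w

  IsStable : Subset n → Set
  IsStable M = ∀ u w → u ∈ M → w ∈ M → ¬ Adj u w

  IsωM : ℕ → Set
  IsωM k = (Σ (Subset n) λ M → IsModule M × IsClique M × ∣ M ∣ ≡ k)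
         × (∀ M → IsModule M → IsClique M → ∣ M ∣ ≤ k)

  IsαM : ℕ → Set
  IsαM k = (Σ (Subset n) λ M → IsModule M × IsStable M × ∣ M ∣ ≡ k)
         × (∀ M → IsModule M → IsStable M → ∣ M ∣ ≤ k)

  IsCandidate : Subset n → Set
  IsCandidate M = IsModule M × 2 ≤ ∣ M ∣ × (IsClique M ⊎ IsStable M)

  In𝕄 : Subset n → Set
  In𝕄 M = IsCandidate M × (∀ N → IsCandidate N → M ⊆ N → N ≡ M)

  Disjoint : Subset n → Subset n → Set
  Disjoint M N = Empty (M ∩ N)

module Submission where

-- Let M ≠ N be elements of 𝕄(G) sharing a vertex x.  Then
-- M ∪ N is again a homogeneous module of size ≥ 2:
--   * the union of two overlapping modules is a module (a vertex outside
--     both sees x either fully or not at all, so it treats M and N alike);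
--   * two overlapping clique modules have a clique union, and two
--     overlapping stable modules a stable union (vertices of M ∖ N relate
--     to N as they relate to x);
--   * a clique module and a stable module of size ≥ 2 cannot overlap:
--     for u ∈ M ∖ {x} and y ∈ N ∖ {x}, the module N forces u ~ y while
--     the module M forces u ≁ y.
-- By maximality M = M ∪ N = N, a contradiction.

open import Defs
open import Data.Nat using (ℕ; _≤_; _⊔_; s≤s)
open import Data.Nat.Properties using (≤-trans)
open import Data.Fin using (Fin)
open import Data.Fin.Properties using (_≟_)
open import Data.Fin.Subset using (Subset; _∈_; _∪_; ∣_∣; ⁅_⁆)
open import Data.Fin.Subset.Properties
  using (_∈?_; x∈p∪q⁺; x∈p∪q⁻; p⊆p∪q; q⊆p∪q; x∈p∩q⁻; p⊆q⇒∣p∣≤∣q∣; x∈⁅x⁆; ∣⁅x⁆∣≡1)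
open import Data.Product using (_,_)
open import Data.Sum using (_⊎_; inj₁; inj₂; [_,_]′)
open import Data.Empty using (⊥; ⊥-elim)
open import Relation.Nullary using (¬_; yes; no)
open import Relation.Nullary.Decidable using (decidable-stable)
open import Relation.Binary.PropositionalEquality
  using (_≡_; _≢_; refl; sym; trans; subst)

notSingleton : ∀ {n} (M : Subset n) (x : Fin n) →
  2 ≤ ∣ M ∣ → ¬ (∀ y → y ∈ M → y ≡ x)
notSingleton M x two≤∣M∣ allX with ≤-trans two≤∣M∣ ∣M∣≤1
  where
    M⊆⁅x⁆ : ∀ {y} → y ∈ M → y ∈ ⁅ x ⁆
    M⊆⁅x⁆ {y} y∈M = subst (_∈ ⁅ x ⁆) (sym (allX y y∈M)) (x∈⁅x⁆ x)
    ∣M∣≤1 : ∣ M ∣ ≤ 1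
    ∣M∣≤1 = subst (∣ M ∣ ≤_) (∣⁅x⁆∣≡1 x) (p⊆q⇒∣p∣≤∣q∣ M⊆⁅x⁆)
... | s≤s ()

-- Hence a subset of size at least 2 has an element other than x, in the
-- form used below: to derive ⊥ it suffices to derive it from such an
-- element (equality on Fin n is decidable, so ¬ y ≢ x gives y ≡ x).
secondElement : ∀ {n} (M : Subset n) (x : Fin n) → 2 ≤ ∣ M ∣ →
  ¬ (∀ y → y ∈ M → y ≢ x → ⊥)
secondElement M x two≤∣M∣ noOther =
  notSingleton M x two≤∣M∣ λ y y∈M → decidable-stable (y ≟ x) (noOther y y∈M)

pairwiseOnUnion : ∀ {n} (R : Fin n → Fin n → Set) →
  (∀ {u w} → R u w → R w u) → (M N : Subset n) →
  (∀ u w → u ∈ M → w ∈ M → R u w) →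
  (∀ u w → u ∈ N → w ∈ N → R u w) →
  (∀ u w → u ∈ M → w ∈ N → R u w) →
  ∀ u w → u ∈ M ∪ N → w ∈ M ∪ N → R u w
pairwiseOnUnion R symR M N inM inN across u w u∈ w∈
  with x∈p∪q⁻ M N u∈ | x∈p∪q⁻ M N w∈
... | inj₁ u∈M | inj₁ w∈M = inM u w u∈M w∈M
... | inj₂ u∈N | inj₂ w∈N = inN u w u∈N w∈N
... | inj₁ u∈M | inj₂ w∈N = across u w u∈M w∈N
... | inj₂ u∈N | inj₁ w∈M = symR (across w u w∈M u∈N)

module Overlapping {n : ℕ} (G : Graph n) where
  open Graph G renaming (sym to Adj-sym)

  -- The union of two modules sharing a vertex x is a module: an outside
  -- vertex's relation to x fixes its relation to all of M and all of N.
  unionModule : ∀ M N x → x ∈ M → x ∈ N →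
    IsModule G M → IsModule G N → IsModule G (M ∪ N)
  unionModule M N x x∈M x∈N modM modN v v∉M∪N
    with modM v (λ v∈M → v∉M∪N (x∈p∪q⁺ (inj₁ v∈M)))
       | modN v (λ v∈N → v∉M∪N (x∈p∪q⁺ (inj₂ v∈N)))
  ... | inj₁ allM  | inj₁ allN  =
    inj₁ λ u u∈ → [ allM u , allN u ]′ (x∈p∪q⁻ M N u∈)
  ... | inj₂ noneM | inj₂ noneN =
    inj₂ λ u u∈ → [ noneM u , noneN u ]′ (x∈p∪q⁻ M N u∈)
  ... | inj₁ allM  | inj₂ noneN = ⊥-elim (noneN x x∈N (allM x x∈M))
  ... | inj₂ noneM | inj₁ allN  = ⊥-elim (noneM x x∈M (allN x x∈N))

  -- Two clique modules sharing x: every u ∈ M ∖ N is adjacent to x ∈ N,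
  -- hence to all of N.
  cliqueAcross : ∀ M N x → x ∈ M → x ∈ N → IsModule G N →
    IsClique G M → IsClique G N →
    ∀ u w → u ∈ M → w ∈ N → u ≢ w → Adj u w
  cliqueAcross M N x x∈M x∈N modN cliqueM cliqueN u w u∈M w∈N u≢w
    with u ∈? N
  ... | yes u∈N = cliqueN u w u∈N w∈N u≢w
  ... | no u∉N with modN u u∉N
  ...   | inj₁ allN  = allN w w∈N
  ...   | inj₂ noneN = ⊥-elim (noneN x x∈N (cliqueM u x u∈M x∈M u≢x))
    where
      u≢x : u ≢ x
      u≢x refl = u∉N x∈N

  unionClique : ∀ M N x → x ∈ M → x ∈ N → IsModule G M → IsModule G N →
    IsClique G M → IsClique G N → IsClique G (M ∪ N)
  unionClique M N x x∈M x∈N modM modN cliqueM cliqueN =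
    pairwiseOnUnion (λ u w → u ≢ w → Adj u w)
      (λ adj w≢u → Adj-sym (adj (λ u≡w → w≢u (sym u≡w)))) M N
      cliqueM cliqueN
      (cliqueAcross M N x x∈M x∈N modN cliqueM cliqueN)

  -- Two stable modules sharing x: every u ∈ M ∖ N is non-adjacent to
  -- x ∈ N, hence to all of N.
  stableAcross : ∀ M N x → x ∈ M → x ∈ N → IsModule G N →
    IsStable G M → IsStable G N →
    ∀ u w → u ∈ M → w ∈ N → ¬ Adj u w
  stableAcross M N x x∈M x∈N modN stableM stableN u w u∈M w∈N
    with u ∈? N
  ... | yes u∈N = stableN u w u∈N w∈N
  ... | no u∉N with modN u u∉N
  ...   | inj₁ allN  = ⊥-elim (stableM u x u∈M x∈M (allN x x∈N))
  ...   | inj₂ noneN = noneN w w∈N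

  unionStable : ∀ M N x → x ∈ M → x ∈ N → IsModule G M → IsModule G N →
    IsStable G M → IsStable G N → IsStable G (M ∪ N)
  unionStable M N x x∈M x∈N modM modN stableM stableN =
    pairwiseOnUnion (λ u w → ¬ Adj u w) (λ nonAdj adj → nonAdj (Adj-sym adj))
      M N stableM stableN
      (stableAcross M N x x∈M x∈N modN stableM stableN)

  -- Then u ∉ N and y ∉ M; the
  -- module N makes u adjacent to y (as u ~ x), the module M makes y
  -- non-adjacent to u (as y ≁ x).
  cliqueStableClash : ∀ M N x → x ∈ M → x ∈ N → IsModule G M → IsModule G N →
    IsClique G M → IsStable G N →
    ∀ u y → u ∈ M → u ≢ x → y ∈ N → y ≢ x → ⊥
  cliqueStableClash M N x x∈M x∈N modM modN cliqueM stableN u y u∈M u≢x y∈N y≢x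
    with u ∈? N | y ∈? M
  ... | yes u∈N | _ = stableN u x u∈N x∈N (cliqueM u x u∈M x∈M u≢x)
  ... | no _ | yes y∈M = stableN y x y∈N x∈N (cliqueM y x y∈M x∈M y≢x)
  ... | no u∉N | no y∉M with modN u u∉N | modM y y∉M
  ...   | inj₂ noneN | _         = noneN x x∈N (cliqueM u x u∈M x∈M u≢x)
  ...   | inj₁ _     | inj₁ allM = stableN y x y∈N x∈N (allM x x∈M)
  ...   | inj₁ allN  | inj₂ noneM = noneM u u∈M (Adj-sym (allN y y∈N))

  noMixedOverlap : ∀ M N x → x ∈ M → x ∈ N → IsCandidate G M → IsCandidate G N →
    IsClique G M → IsStable G N → ⊥
  noMixedOverlap M N x x∈M x∈N (modM , two≤∣M∣ , _) (modN , two≤∣N∣ , _) cliqueM stableN =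
    secondElement M x two≤∣M∣ λ u u∈M u≢x →
      secondElement N x two≤∣N∣ λ y y∈N y≢x →
        cliqueStableClash M N x x∈M x∈N modM modN cliqueM stableN u y u∈M u≢x y∈N y≢x

  unionCandidate : ∀ M N x → x ∈ M → x ∈ N →
    IsCandidate G M → IsCandidate G N → IsCandidate G (M ∪ N)
  unionCandidate M N x x∈M x∈N candM@(modM , two≤∣M∣ , kindM) candN@(modN , _ , kindN) =
    unionModule M N x x∈M x∈N modM modN ,
    ≤-trans two≤∣M∣ (p⊆q⇒∣p∣≤∣q∣ (p⊆p∪q {p = M} N)) ,
    unionKind kindM kindN
    where
      unionKind : IsClique G M ⊎ IsStable G M → IsClique G N ⊎ IsStable G N →
        IsClique G (M ∪ N) ⊎ IsStable G (M ∪ N)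
      unionKind (inj₁ cliqueM) (inj₁ cliqueN) =
        inj₁ (unionClique M N x x∈M x∈N modM modN cliqueM cliqueN)
      unionKind (inj₂ stableM) (inj₂ stableN) =
        inj₂ (unionStable M N x x∈M x∈N modM modN stableM stableN)
      unionKind (inj₁ cliqueM) (inj₂ stableN) =
        ⊥-elim (noMixedOverlap M N x x∈M x∈N candM candN cliqueM stableN)
      unionKind (inj₂ stableM) (inj₁ cliqueN) =
        ⊥-elim (noMixedOverlap N M x x∈N x∈M candN candM cliqueN stableM)

  maximalDisjoint : ∀ M N → In𝕄 G M → In𝕄 G N → M ≢ N → Disjoint G M N
  maximalDisjoint M N (candM , maxM) (candN , maxN) M≢N (x , x∈M∩N)
    with x∈p∩q⁻ M N x∈M∩N
  ... | x∈M , x∈N = M≢N (trans (sym M∪N≡M) M∪N≡N)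
    where
      candM∪N : IsCandidate G (M ∪ N)
      candM∪N = unionCandidate M N x x∈M x∈N candM candN
      M∪N≡M : M ∪ N ≡ M
      M∪N≡M = maxM (M ∪ N) candM∪N (p⊆p∪q {p = M} N)
      M∪N≡N : M ∪ N ≡ N
      M∪N≡N = maxN (M ∪ N) candM∪N (q⊆p∪q M N)

corollary5 : (n : ℕ) (G : Graph n) (a w : ℕ) →
    IsαM G a → IsωM G w → 2 ≤ a ⊔ w →
    (M N : Subset n) → In𝕄 G M → In𝕄 G N → M ≢ N → Disjoint G M N
corollary5 n G a w _ _ _ = Overlapping.maximalDisjoint G
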